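{- For every positive integer $k$ there exist a binary matrix $A_k$ and binary column vectors $x_1,\dots,x_k$ such that $R_{binary}(A_k|x_i)=R_{binary}(A_k)=4$ for every $1\le i\le k$, but $R_{binary}(A_k|x_1,\dots,x_k)=k+3$.
   Context: A binary matrix has entries in $\{0,1\}$. The binary rank $R_{binary}(A)$ of an $n\times m$ binary matrix $A$ is the minimal $k$ such that $A=U\cdot V$ with $U$ an $n\times k$ and $V$ a $k\times m$ binary matrix, using ordinary integer arithmetic. $(A|x_1,\dots,x_t)$ denotes $A$ with the column vectors $x_1,\dots,x_t$ appended as additional columns. -}

module Defs where

open import Data.Nat using (ℕ; zero; suc; _+_; _*_; _<_)
open import Data.Fin using (Fin; splitAt) renaming (zero to fzero; suc to fsuc)
open import Data.Sum using ([_,_])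
open import Data.Product using (Σ; ∃; _×_)
open import Relation.Binary.PropositionalEquality using (_≡_)
open import Relation.Nullary using (¬_)
open import Data.Sum using (_⊎_)

Matrix : ℕ → ℕ → Set
Matrix n m = Fin n → Fin m → ℕ

Column : ℕ → Set
Column n = Fin n → ℕ

IsBit : ℕ → Set
IsBit x = (x ≡ 0) ⊎ (x ≡ 1)

IsBinary : ∀ {n m} → Matrix n m → Set
IsBinary A = ∀ i j → IsBit (A i j)

IsBinaryColumn : ∀ {n} → Column n → Set
IsBinaryColumn x = ∀ i → IsBit (x i)

Σ[<_] : (k : ℕ) → (Fin k → ℕ) → ℕ
Σ[< zero ] f = 0
Σ[< suc k ] f = f fzero + Σ[< k ] (λ l → f (fsuc l))

_⊗_ : ∀ {n k m} → Matrix n k → Matrix k m → Matrix n m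
_⊗_ {k = k} U V i j = Σ[< k ] (λ l → U i l * V l j)

HasBinaryFactorization : ∀ {n m} → Matrix n m → ℕ → Set
HasBinaryFactorization {n} {m} A k =
  Σ (Matrix n k) λ U → Σ (Matrix k m) λ V →
    IsBinary U × IsBinary V × (∀ i j → A i j ≡ (U ⊗ V) i j)

BinaryRank : ∀ {n m} → Matrix n m → ℕ → Set
BinaryRank A r = HasBinaryFactorization A r × (∀ k → k < r → ¬ HasBinaryFactorization A k)

appendCols : ∀ {n m t} → Matrix n m → (Fin t → Column n) → Matrix n (m + t)
appendCols {m = m} A xs i j = [ (λ j' → A i j') , (λ l → xs l i) ] (splitAt m j)

appendCol : ∀ {n m} → Matrix n m → Column n → Matrix n (m + 1)
appendCol A x = appendCols A (λ _ → x)

-- The rows a = 1100, b = 0011, c = 1010, d = 0101 of A satisfy a + b = c + d = 1111, and A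
-- repeats the row 1111 once per vector. A fooling set on a, b, c, d gives rank 4, and it
-- survives appending columns. The vector x_i is 1 exactly in row a and in the i-th copy of
-- 1111, so (A | x_i) still has rank 4: that copy is written as a + b and all other copies as
-- c + d. Appending all x_i at once separates the copies: each needs its own rank-one piece,
-- and rows b, c, d together with the copies form a fooling set of size k + 3.
module Submission where

open import Defs
open import Data.Bool using (Bool; true; false; if_then_else_)
open import Data.Nat using (ℕ; zero; suc; _+_; _*_; _≤_; _≟_)
open import Data.Nat.Properties using (+-comm; +-identityʳ; *-comm; *-zeroʳ; <⇒≱; m+n≡0⇒m≡0; m+n≡0⇒n≡0; m*n≡0⇒m≡0∨n≡0)
open import Data.Fin using (Fin; splitAt; _↑ˡ_) renaming (zero to fzero; suc to fsuc)
open import Data.Fin.Properties using (injective⇒≤; all?; splitAt-↑ˡ) renaming (_≟_ to _≟ᶠ_)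
open import Data.Vec.Functional using (Vector; []; _∷_; _++_; replicate)
open import Data.Product using (Σ; _×_; _,_; proj₁; proj₂; ∃)
open import Data.Sum using (inj₁; inj₂; [_,_])
open import Data.Sum.Properties using ([,]-∘)
open import Data.Empty using (⊥-elim)
open import Function using (_∘_)
open import Relation.Nullary using (yes; no)
open import Relation.Nullary.Decidable using (True; toWitness; from-yes; ¬?; _→-dec_)
open import Relation.Binary.PropositionalEquality using (_≡_; _≢_; refl; sym; trans; cong; cong₂; subst)

pattern F0 = fzero
pattern F1 = fsuc fzero
pattern F2 = fsuc (fsuc fzero)
pattern F3 = fsuc (fsuc (fsuc fzero))
pattern F3+ j = fsuc (fsuc (fsuc j))
pattern F4+ j = fsuc (fsuc (fsuc (fsuc j)))

pattern O = false
pattern I = true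

Σ-cong : ∀ n {f g : Fin n → ℕ} → (∀ l → f l ≡ g l) → Σ[< n ] f ≡ Σ[< n ] g
Σ-cong zero    f≗g = refl
Σ-cong (suc n) f≗g = cong₂ _+_ (f≗g fzero) (Σ-cong n (f≗g ∘ fsuc))

Σ-zero : ∀ n → Σ[< n ] (λ _ → 0) ≡ 0
Σ-zero zero    = refl
Σ-zero (suc n) = Σ-zero n

-- The shape of an entry of U ⊗ V whose row of U selects a single inner index.
Σ-zero-padding : ∀ m n → (m + 0) + Σ[< n ] (λ _ → 0) ≡ m
Σ-zero-padding m n = trans (cong₂ _+_ (+-identityʳ m) (Σ-zero n)) (+-identityʳ m)

Σ≢0⇒∃≢0 : ∀ n (f : Fin n → ℕ) → Σ[< n ] f ≢ 0 → ∃ λ l → f l ≢ 0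
Σ≢0⇒∃≢0 zero    f Σf≢0 = ⊥-elim (Σf≢0 refl)
Σ≢0⇒∃≢0 (suc n) f Σf≢0 with f fzero ≟ 0
... | no  f₀≢0 = fzero , f₀≢0
... | yes f₀≡0 =
  let l , fₗ≢0 = Σ≢0⇒∃≢0 n (f ∘ fsuc) (λ Σ≡0 → Σf≢0 (cong₂ _+_ f₀≡0 Σ≡0))
  in fsuc l , fₗ≢0

≢0⇒Σ≢0 : ∀ n (f : Fin n → ℕ) l → f l ≢ 0 → Σ[< n ] f ≢ 0
≢0⇒Σ≢0 (suc n) f fzero    f₀≢0 Σ≡0 = f₀≢0 (m+n≡0⇒m≡0 (f fzero) Σ≡0)
≢0⇒Σ≢0 (suc n) f (fsuc l) fₗ≢0 Σ≡0 = ≢0⇒Σ≢0 n (f ∘ fsuc) l fₗ≢0 (m+n≡0⇒n≡0 (f fzero) Σ≡0)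

record FoolingSet {n m} (M : Matrix n m) (s : ℕ) : Set where
  field
    row          : Fin s → Fin n
    col          : Fin s → Fin m
    diagonal     : ∀ a → M (row a) (col a) ≢ 0
    off-diagonal : ∀ a b → a ≢ b → M (row a) (col b) * M (row b) (col a) ≡ 0

-- Each diagonal entry is carried by some inner index; two fooled pairs sharing one would make
-- both of their cross entries nonzero.
foolingSet-bound : ∀ {n m s t} {M : Matrix n m} → FoolingSet M s →
  (U : Matrix n t) (V : Matrix t m) → (∀ i j → M i j ≡ (U ⊗ V) i j) → s ≤ t
foolingSet-bound {t = t} {M} F U V M≡UV = injective⇒≤ carrier-injective
  where
  open FoolingSet F

  carried : ∀ a → ∃ λ l → U (row a) l * V l (col a) ≢ 0
  carried a = Σ≢0⇒∃≢0 t _ (λ Σ≡0 → diagonal a (trans (M≡UV _ _) Σ≡0))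

  carrier : Fin _ → Fin t
  carrier a = proj₁ (carried a)

  cross-nonzero : ∀ a b → carrier a ≡ carrier b → M (row a) (col b) ≢ 0
  cross-nonzero a b same M≡0 = ≢0⇒Σ≢0 t _ (carrier a) product≢0 (trans (sym (M≡UV _ _)) M≡0)
    where
    Ua≢0 : U (row a) (carrier a) ≢ 0
    Ua≢0 Ua≡0 = proj₂ (carried a) (cong (_* V (carrier a) (col a)) Ua≡0)
    Vb≢0 : V (carrier a) (col b) ≢ 0
    Vb≢0 Vb≡0 = proj₂ (carried b) (subst (λ l → U (row b) l * V l (col b) ≡ 0) same
      (trans (cong (U (row b) (carrier a) *_) Vb≡0) (*-zeroʳ (U (row b) (carrier a)))))
    product≢0 : U (row a) (carrier a) * V (carrier a) (col b) ≢ 0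
    product≢0 p≡0 = [ Ua≢0 , Vb≢0 ] (m*n≡0⇒m≡0∨n≡0 _ p≡0)

  carrier-injective : ∀ {a b} → carrier a ≡ carrier b → a ≡ b
  carrier-injective {a} {b} same with a ≟ᶠ b
  ... | yes a≡b = a≡b
  ... | no  a≢b = ⊥-elim
    ([ cross-nonzero a b same , cross-nonzero b a (sym same) ] (m*n≡0⇒m≡0∨n≡0 _ (off-diagonal a b a≢b)))

foolingSet⇒≤ : ∀ {n m s t} {M : Matrix n m} → FoolingSet M s → HasBinaryFactorization M t → s ≤ t
foolingSet⇒≤ F (U , V , _ , _ , M≡UV) = foolingSet-bound F U V M≡UV

binaryRank-intro : ∀ {n m r} {M : Matrix n m} → HasBinaryFactorization M r →
  (∀ {t} → HasBinaryFactorization M t → r ≤ t) → BinaryRank M r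
binaryRank-intro factorization lower-bound = factorization , λ t t<r f → <⇒≱ t<r (lower-bound f)

hasBinaryFactorization-dropCols : ∀ {n m t r} {A : Matrix n m} {xs : Fin t → Column n} →
  HasBinaryFactorization (appendCols A xs) r → HasBinaryFactorization A r
hasBinaryFactorization-dropCols {m = m} {t} {A = A} {xs} (U , V , U-binary , V-binary , eq) =
  U , (λ l j → V l (j ↑ˡ t)) , U-binary , (λ l j → V-binary l (j ↑ˡ t)) ,
  λ i j → trans (cong [ A i , (λ l → xs l i) ] (sym (splitAt-↑ˡ m j t))) (eq i (j ↑ˡ t))

bit : Bool → ℕ
bit O = 0
bit I = 1

BitMatrix : ℕ → ℕ → Set
BitMatrix n m = Fin n → Fin m → Bool

bits : ∀ {n} → Vector Bool n → Column n
bits v i = bit (v i)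

⟦_⟧ : ∀ {n m} → BitMatrix n m → Matrix n m
⟦ B ⟧ i = bits (B i)

bits-isBinary : ∀ {n} (v : Vector Bool n) → IsBinaryColumn (bits v)
bits-isBinary v i with v i
... | O = inj₁ refl
... | I = inj₂ refl

⟦⟧-isBinary : ∀ {n m} (B : BitMatrix n m) → IsBinary ⟦ B ⟧
⟦⟧-isBinary B i = bits-isBinary (B i)

⟦⟧-appendCols : ∀ {n m t} (A : BitMatrix n m) (xs : Fin t → Vector Bool n) i j →
  bit ((A i ++ λ l → xs l i) j) ≡ appendCols ⟦ A ⟧ (bits ∘ xs) i j
⟦⟧-appendCols {m = m} A xs i j = [,]-∘ bit (splitAt m j)

≗-by-computation : ∀ {n} {f g : Vector ℕ n} → {True (all? λ c → f c ≟ g c)} → ∀ c → f c ≡ g c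
≗-by-computation {_} {_} {_} {p} = toWitness p

δ : ∀ {n} → Fin n → Fin n → Bool
δ fzero    fzero    = I
δ fzero    (fsuc _) = O
δ (fsuc _) fzero    = O
δ (fsuc i) (fsuc j) = δ i j

δ-refl : ∀ {n} (i : Fin n) → δ i i ≡ I
δ-refl fzero    = refl
δ-refl (fsuc i) = δ-refl i

δ-sym : ∀ {n} (i j : Fin n) → δ i j ≡ δ j i
δ-sym fzero    fzero    = refl
δ-sym fzero    (fsuc _) = refl
δ-sym (fsuc _) fzero    = refl
δ-sym (fsuc i) (fsuc j) = δ-sym i j

δ-≢ : ∀ {n} {i j : Fin n} → i ≢ j → δ i j ≡ O
δ-≢ {i = fzero}  {fzero}  i≢j = ⊥-elim (i≢j refl)
δ-≢ {i = fzero}  {fsuc _} i≢j = refl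
δ-≢ {i = fsuc _} {fzero}  i≢j = refl
δ-≢ {i = fsuc i} {fsuc j} i≢j = δ-≢ (i≢j ∘ cong fsuc)

Σ-δˡ : ∀ {n} (j : Fin n) (f : Fin n → ℕ) → Σ[< n ] (λ l → bit (δ j l) * f l) ≡ f j
Σ-δˡ {suc n} fzero    f = Σ-zero-padding (f fzero) n
Σ-δˡ         (fsuc j) f = Σ-δˡ j (f ∘ fsuc)

Σ-δʳ : ∀ {n} (j : Fin n) (f : Fin n → ℕ) → Σ[< n ] (λ l → f l * bit (δ l j)) ≡ f j
Σ-δʳ {n} j f = trans (Σ-cong n λ l → trans (*-comm (f l) _) (cong (λ b → bit b * f l) (δ-sym l j)))
                     (Σ-δˡ j f)

hasBinaryFactorization-identity : ∀ {n m} {M : Matrix n m} → IsBinary M → HasBinaryFactorization M m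
hasBinaryFactorization-identity {M = M} M-binary =
  M , ⟦ δ ⟧ , M-binary , ⟦⟧-isBinary δ , λ i j → sym (Σ-δʳ j (M i))

module Construction (K : ℕ) where

  A : BitMatrix (4 + K) 4
  A F0      = I ∷ I ∷ O ∷ O ∷ []
  A F1      = O ∷ O ∷ I ∷ I ∷ []
  A F2      = I ∷ O ∷ I ∷ O ∷ []
  A F3      = O ∷ I ∷ O ∷ I ∷ []
  A (F4+ _) = I ∷ I ∷ I ∷ I ∷ []

  x : Fin K → Vector Bool (4 + K)
  x i = I ∷ O ∷ O ∷ O ∷ λ j → δ j i

  A-foolingSet : FoolingSet ⟦ A ⟧ 4
  A-foolingSet = record
    { row          = _↑ˡ K
    ; col          = col
    ; diagonal     = from-yes (all? λ a → ¬? (⟦ A ⟧ (a ↑ˡ K) (col a) ≟ 0))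
    ; off-diagonal = from-yes (all? λ a → all? λ b →
        ¬? (a ≟ᶠ b) →-dec (⟦ A ⟧ (a ↑ˡ K) (col b) * ⟦ A ⟧ (b ↑ˡ K) (col a) ≟ 0))
    }
    where
    col : Fin 4 → Fin 4
    col = F0 ∷ F3 ∷ F2 ∷ F1 ∷ []

  A-rank : BinaryRank ⟦ A ⟧ 4
  A-rank = binaryRank-intro (hasBinaryFactorization-identity (⟦⟧-isBinary A)) (foolingSet⇒≤ A-foolingSet)

  U₁ : Fin K → BitMatrix (4 + K) 4
  U₁ i F0      = I ∷ O ∷ O ∷ O ∷ []
  U₁ i F1      = O ∷ I ∷ O ∷ O ∷ []
  U₁ i F2      = O ∷ O ∷ I ∷ O ∷ []
  U₁ i F3      = O ∷ O ∷ O ∷ I ∷ []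
  U₁ i (F4+ j) = if δ j i then I ∷ I ∷ O ∷ O ∷ [] else O ∷ O ∷ I ∷ I ∷ []

  V₁ : BitMatrix 4 5
  V₁ F0 = I ∷ I ∷ O ∷ O ∷ I ∷ []
  V₁ F1 = O ∷ O ∷ I ∷ I ∷ O ∷ []
  V₁ F2 = I ∷ O ∷ I ∷ O ∷ O ∷ []
  V₁ F3 = O ∷ I ∷ O ∷ I ∷ O ∷ []

  A∣xᵢ-factorization : ∀ i r c → appendCol ⟦ A ⟧ (bits (x i)) r c ≡ (⟦ U₁ i ⟧ ⊗ ⟦ V₁ ⟧) r c
  A∣xᵢ-factorization i F0 = ≗-by-computation
  A∣xᵢ-factorization i F1 = ≗-by-computation
  A∣xᵢ-factorization i F2 = ≗-by-computation
  A∣xᵢ-factorization i F3 = ≗-by-computation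
  A∣xᵢ-factorization i (F4+ j) with δ j i
  ... | I = ≗-by-computation
  ... | O = ≗-by-computation

  A∣xᵢ-rank : ∀ i → BinaryRank (appendCol ⟦ A ⟧ (bits (x i))) 4
  A∣xᵢ-rank i = binaryRank-intro
    (⟦ U₁ i ⟧ , ⟦ V₁ ⟧ , ⟦⟧-isBinary (U₁ i) , ⟦⟧-isBinary V₁ , A∣xᵢ-factorization i)
    (foolingSet⇒≤ A-foolingSet ∘ hasBinaryFactorization-dropCols)

module _ (k : ℕ) where
  open Construction (suc k)

  X : BitMatrix (4 + suc k) (4 + suc k)
  X r = A r ++ λ i → x i r

  V₂ : BitMatrix (3 + suc k) (4 + suc k)
  V₂ F0      = X F1
  V₂ F1      = X F2
  V₂ F2      = X F3
  V₂ (F3+ i) = δ i F0 ∷ δ i F0 ∷ O ∷ O ∷ δ i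

  U₂ : BitMatrix (4 + suc k) (3 + suc k)
  U₂ F0             = O ∷ O ∷ O ∷ replicate _ I
  U₂ F1             = I ∷ O ∷ O ∷ replicate _ O
  U₂ F2             = O ∷ I ∷ O ∷ replicate _ O
  U₂ F3             = O ∷ O ∷ I ∷ replicate _ O
  U₂ (F4+ F0)       = I ∷ O ∷ O ∷ δ F0
  U₂ (F4+ (fsuc j)) = O ∷ I ∷ I ∷ δ (fsuc j)

  X-first-copy : ∀ c → bit (X (F4+ F0) c) ≡ bit (X F1 c) + bit (V₂ (F3+ F0) c)
  X-first-copy F0      = refl
  X-first-copy F1      = refl
  X-first-copy F2      = refl
  X-first-copy F3      = refl
  X-first-copy (F4+ i) = refl

  X-other-copy : ∀ j c → bit (X (F4+ (fsuc j)) c) ≡ bit (X F2 c) + (bit (X F3 c) + bit (V₂ (F3+ (fsuc j)) c))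
  X-other-copy j F0      = refl
  X-other-copy j F1      = refl
  X-other-copy j F2      = refl
  X-other-copy j F3      = refl
  X-other-copy j (F4+ i) = refl

  X-factorization : ∀ r c → bit (X r c) ≡ (⟦ U₂ ⟧ ⊗ ⟦ V₂ ⟧) r c
  X-factorization F0 F0      = sym (Σ-δʳ {suc k} F0 λ _ → 1)
  X-factorization F0 F1      = sym (Σ-δʳ {suc k} F0 λ _ → 1)
  X-factorization F0 F2      = sym (Σ-zero (suc k))
  X-factorization F0 F3      = sym (Σ-zero (suc k))
  X-factorization F0 (F4+ i) = sym (Σ-δʳ i λ _ → 1)
  X-factorization F1 c       = sym (Σ-zero-padding (bit (X F1 c)) (suc k))
  X-factorization F2 c       = sym (Σ-zero-padding (bit (X F2 c)) (suc k))
  X-factorization F3 c       = sym (Σ-zero-padding (bit (X F3 c)) (suc k))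
  X-factorization (F4+ F0) c = trans (X-first-copy c)
    (cong₂ _+_ (sym (+-identityʳ (bit (X F1 c)))) (sym (Σ-δˡ F0 λ i → bit (V₂ (F3+ i) c))))
  X-factorization (F4+ (fsuc j)) c = trans (X-other-copy j c)
    (cong₂ _+_ (sym (+-identityʳ (bit (X F2 c))))
      (cong₂ _+_ (sym (+-identityʳ (bit (X F3 c)))) (sym (Σ-δˡ (fsuc j) λ i → bit (V₂ (F3+ i) c)))))

  A∣X-factorization : HasBinaryFactorization (appendCols ⟦ A ⟧ (bits ∘ x)) (3 + suc k)
  A∣X-factorization = ⟦ U₂ ⟧ , ⟦ V₂ ⟧ , ⟦⟧-isBinary U₂ , ⟦⟧-isBinary V₂ ,
    λ r c → trans (sym (⟦⟧-appendCols A x r c)) (X-factorization r c)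

  A∣X-foolingSet : FoolingSet (appendCols ⟦ A ⟧ (bits ∘ x)) (3 + suc k)
  A∣X-foolingSet = record { row = fsuc ; col = col ; diagonal = diagonal ; off-diagonal = off-diagonal }
    where
    M : Matrix (4 + suc k) (4 + suc k)
    M = appendCols ⟦ A ⟧ (bits ∘ x)

    col : Fin (3 + suc k) → Fin (4 + suc k)
    col = F3 ∷ F2 ∷ F1 ∷ λ i → F4+ i

    diagonal : ∀ a → M (fsuc a) (col a) ≢ 0
    diagonal F0 = λ ()
    diagonal F1 = λ ()
    diagonal F2 = λ ()
    diagonal (F3+ i) rewrite δ-refl i = λ ()

    off-diagonal : ∀ a b → a ≢ b → M (fsuc a) (col b) * M (fsuc b) (col a) ≡ 0
    off-diagonal F0      F0      a≢b = ⊥-elim (a≢b refl)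
    off-diagonal F0      F1      _   = refl
    off-diagonal F0      F2      _   = refl
    off-diagonal F0      (F3+ _) _   = refl
    off-diagonal F1      F0      _   = refl
    off-diagonal F1      F1      a≢b = ⊥-elim (a≢b refl)
    off-diagonal F1      F2      _   = refl
    off-diagonal F1      (F3+ _) _   = refl
    off-diagonal F2      F0      _   = refl
    off-diagonal F2      F1      _   = refl
    off-diagonal F2      F2      a≢b = ⊥-elim (a≢b refl)
    off-diagonal F2      (F3+ _) _   = refl
    off-diagonal (F3+ _) F0      _   = refl
    off-diagonal (F3+ _) F1      _   = refl
    off-diagonal (F3+ _) F2      _   = refl
    off-diagonal (F3+ i) (F3+ j) i≢j = cong (λ b → bit b * bit (δ j i)) (δ-≢ (i≢j ∘ cong λ l → F3+ l))

  A∣X-rank : BinaryRank (appendCols ⟦ A ⟧ (bits ∘ x)) (3 + suc k)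
  A∣X-rank = binaryRank-intro A∣X-factorization (foolingSet⇒≤ A∣X-foolingSet)

theorem5 : (k : ℕ) → 1 ≤ k →
    Σ ℕ λ n → Σ ℕ λ m → Σ (Matrix n m) λ A → Σ (Fin k → Column n) λ xs →
      IsBinary A × (∀ i → IsBinaryColumn (xs i)) ×
      BinaryRank A 4 × (∀ i → BinaryRank (appendCol A (xs i)) 4) ×
      BinaryRank (appendCols A xs) (k + 3)
theorem5 zero ()
theorem5 (suc k) _ =
  4 + suc k , 4 , ⟦ A ⟧ , bits ∘ x , ⟦⟧-isBinary A , bits-isBinary ∘ x ,
  A-rank , A∣xᵢ-rank , subst (BinaryRank _) (+-comm 3 (suc k)) (A∣X-rank k)
  where open Construction (suc k)
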